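{- Let $G$ be a connected graph with diameter at most $2$. Then the spectrum of $D^Q(G)$ (respectively, of $D^{\deg}(G)$) is determined by the spectrum of $2J-Q(G)$, and conversely. Moreover, if $G$ is regular, then the spectrum of $D^Q(G)$ (respectively, of $D^{\deg}(G)$) is determined by the spectrum of $Q(G)$, and conversely.
   Context: $J$ is the all-ones matrix. For a connected graph $G$: $A$ is its adjacency matrix, $D$ its distance matrix, $\operatorname{trs}(v)=\sum_u d(u,v)$, $Q=\operatorname{diag}(\deg(G))+A$, $D^Q=\operatorname{diag}(\operatorname{trs}(G))+D$, $D^{\deg}=\operatorname{diag}(\deg(G))-D$. -}

module Defs where

open import Data.Nat as ℕ using (ℕ; zero; suc)
open import Data.Integer as ℤ using (ℤ; +_; _-_; _*_)
open import Data.Fin using (Fin; zero; suc; punchIn)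
open import Data.Bool using (Bool; true; false; if_then_else_)
open import Data.Product using (Σ; _×_; ∃; ∃-syntax)
open import Relation.Binary.PropositionalEquality using (_≡_)
open import Function.Bundles using (_⇔_)

Mat : ℕ → Set
Mat n = Fin n → Fin n → ℤ

sumFin : {n : ℕ} → (Fin n → ℤ) → ℤ
sumFin {zero}  f = + 0
sumFin {suc n} f = f zero ℤ.+ sumFin (λ i → f (suc i))

sumFinℕ : {n : ℕ} → (Fin n → ℕ) → ℕ
sumFinℕ {zero}  f = 0
sumFinℕ {suc n} f = f zero ℕ.+ sumFinℕ (λ i → f (suc i))

sign : ℕ → ℤ
sign zero          = + 1
sign (suc zero)    = ℤ.- (+ 1)
sign (suc (suc k)) = sign k

det : {n : ℕ} → Mat n → ℤ
det {zero}  M = + 1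
det {suc n} M = sumFin {suc n} (λ j → sign (Data.Fin.toℕ j) * M zero j
                                  * det {n} (λ i k → M (suc i) (punchIn j k)))

δ : {n : ℕ} → Fin n → Fin n → ℤ
δ {suc n} zero    zero    = + 1
δ {suc n} zero    (suc j) = + 0
δ {suc n} (suc i) zero    = + 0
δ {suc n} (suc i) (suc j) = δ i j

I : {n : ℕ} → Mat n
I = δ

J : {n : ℕ} → Mat n
J _ _ = + 1

diag : {n : ℕ} → (Fin n → ℤ) → Mat n
diag f i j = f i * δ i j

_⊕_ : {n : ℕ} → Mat n → Mat n → Mat n
(M ⊕ N) i j = M i j ℤ.+ N i j

_⊖_ : {n : ℕ} → Mat n → Mat n → Mat n
(M ⊖ N) i j = M i j - N i j

_·_ : {n : ℕ} → ℤ → Mat n → Mat n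
(c · M) i j = c * M i j

charPolyAt : {n : ℕ} → Mat n → ℤ → ℤ
charPolyAt M t = det ((t · I) ⊖ M)

-- Two integer matrices have the same spectrum (eigenvalues with multiplicity)
-- iff their characteristic polynomials coincide; integer polynomials coincide
-- iff they agree at every integer.
Cospectral : {n : ℕ} → Mat n → Mat n → Set
Cospectral M N = ∀ t → charPolyAt M t ≡ charPolyAt N t

record Graph (n : ℕ) : Set where
  field
    adj     : Fin n → Fin n → Bool
    adjSym  : ∀ i j → adj i j ≡ adj j i
    adjIrr  : ∀ i → adj i i ≡ false
open Graph public

data Walk {n : ℕ} (G : Graph n) : Fin n → Fin n → ℕ → Set where
  nil  : ∀ {u} → Walk G u u 0
  cons : ∀ {u w v k} → adj G u w ≡ true → Walk G w v k → Walk G u v (suc k)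

Connected : {n : ℕ} → Graph n → Set
Connected G = ∀ u v → ∃[ k ] Walk G u v k

IsDistance : {n : ℕ} → Graph n → (Fin n → Fin n → ℕ) → Set
IsDistance G d = ∀ u v → Walk G u v (d u v) × (∀ k → Walk G u v k → d u v ℕ.≤ k)

DiameterAtMost2 : {n : ℕ} → (Fin n → Fin n → ℕ) → Set
DiameterAtMost2 d = ∀ u v → d u v ℕ.≤ 2

deg : {n : ℕ} → Graph n → Fin n → ℕ
deg G i = sumFinℕ (λ j → if adj G i j then 1 else 0)

Regular : {n : ℕ} → Graph n → Set
Regular G = ∃[ k ] (∀ i → deg G i ≡ k)

Aₘ : {n : ℕ} → Graph n → Mat n
Aₘ G i j = if adj G i j then + 1 else + 0

Dₘ : {n : ℕ} → (Fin n → Fin n → ℕ) → Mat n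
Dₘ d i j = + d i j

trs : {n : ℕ} → (Fin n → Fin n → ℕ) → Fin n → ℕ
trs d v = sumFinℕ (λ u → d u v)

Qₘ : {n : ℕ} → Graph n → Mat n
Qₘ G = diag (λ i → + deg G i) ⊕ Aₘ G

DQₘ : {n : ℕ} → (Fin n → Fin n → ℕ) → Mat n
DQₘ d = diag (λ i → + trs d i) ⊕ Dₘ d

Ddegₘ : {n : ℕ} → Graph n → (Fin n → Fin n → ℕ) → Mat n
Ddegₘ G d = diag (λ i → + deg G i) ⊖ Dₘ d

twoJminusQ : {n : ℕ} → Graph n → Mat n
twoJminusQ G = ((+ 2) · J) ⊖ Qₘ G

{-# OPTIONS --safe #-}
-- For diameter at most two, D = 2(J - I) - A and trs v = 2n - 2 - deg v, so
-- D^Q = (2n - 4)I + (2J - Q) and D^deg = 2I - (2J - Q): their characteristic polynomials are that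
-- of 2J - Q, shifted by 2n - 4, resp. reflected by t ↦ 2 - t and multiplied by (-1)ⁿ.
-- If G is k-regular, tI + Q has constant column sums t + 2k, and the rank-one perturbation by 2J gives
-- (t + 2k) χ_{2J-Q}(t) = ± (t + 2k - 2n) χ_Q(-t). Cospectrality of either pair forces equal degrees
-- k (compare traces, i.e. second coefficients), and the linear factors cancel because
-- characteristic polynomials are polynomial functions on ℤ.
module Submission where

open import Defs
open import Data.Nat as ℕ using (ℕ; zero; suc)
import Data.Nat.Properties as ℕP
open import Data.Integer as ℤ using (ℤ; +_; _-_; _*_; _+_; -_; _^_; ∣_∣)
import Data.Integer.Properties as ℤP
open import Data.Integer.Tactic.RingSolver using (solve-∀)
open import Data.Fin using (Fin; zero; suc; punchIn; lift; toℕ; fromℕ<; _≟_)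
open import Data.Fin.Properties using (suc-injective; toℕ<n; toℕ-fromℕ<; toℕ-injective)
open import Data.Vec.Functional using (updateAt)
open import Data.Vec.Functional.Properties using (updateAt-updates; updateAt-minimal)
open import Data.Bool using (true; false; if_then_else_)
open import Data.Empty using (⊥-elim)
open import Data.Product using (Σ; _×_; _,_; proj₁; proj₂)
open import Data.Sum using (inj₁; inj₂)
open import Function using (_∘_; const)
open import Function.Bundles using (_⇔_; mk⇔; Equivalence)
open import Function.Construct.Composition using (_⇔-∘_)
open import Relation.Nullary using (does; yes; no)
open import Relation.Binary.PropositionalEquality
open import Algebra.Properties.CommutativeSemigroup ℤP.+-commutativeSemigroup using (interchange)
open import Algebra.Properties.AbelianGroup ℤP.+-0-abelianGroup using (inverseˡ-unique; inverseʳ-unique)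
open ≡-Reasoning

sumFin-cong : ∀ {n} {f g : Fin n → ℤ} → f ≗ g → sumFin f ≡ sumFin g
sumFin-cong {zero}  f≗g = refl
sumFin-cong {suc n} f≗g = cong₂ _+_ (f≗g zero) (sumFin-cong (f≗g ∘ suc))

sumFin-+ : ∀ {n} (f g : Fin n → ℤ) → sumFin (λ i → f i + g i) ≡ sumFin f + sumFin g
sumFin-+ {zero}  f g = refl
sumFin-+ {suc n} f g = trans (cong (_+_ (f zero + g zero)) (sumFin-+ (f ∘ suc) (g ∘ suc)))
                             (interchange (f zero) (g zero) _ _)

sumFin-zero : ∀ {n} {f : Fin n → ℤ} → (∀ i → f i ≡ + 0) → sumFin f ≡ + 0
sumFin-zero {zero}  f≡0 = refl
sumFin-zero {suc n} f≡0 = cong₂ _+_ (f≡0 zero) (sumFin-zero (f≡0 ∘ suc))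

*-sumFin : ∀ {n} c (f : Fin n → ℤ) → c * sumFin f ≡ sumFin (λ i → c * f i)
*-sumFin {zero}  c f = ℤP.*-zeroʳ c
*-sumFin {suc n} c f = trans (ℤP.*-distribˡ-+ c (f zero) _) (cong (_+_ (c * f zero)) (*-sumFin c (f ∘ suc)))

neg-sumFin : ∀ {n} (f : Fin n → ℤ) → - sumFin f ≡ sumFin (λ i → - f i)
neg-sumFin f = trans (sym (ℤP.-1*i≡-i (sumFin f)))
                     (trans (*-sumFin (- + 1) f) (sumFin-cong (ℤP.-1*i≡-i ∘ f)))

sumFin-const : ∀ n (c : ℤ) → sumFin {n} (λ _ → c) ≡ c * + n
sumFin-const zero    c = sym (ℤP.*-zeroʳ c)
sumFin-const (suc n) c = trans (cong (_+_ c) (sumFin-const n c)) (lemma c (+ n))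
  where
  lemma : ∀ c n → c + c * n ≡ c * (+ 1 + n)
  lemma = solve-∀

sumFin-single : ∀ {n} {f : Fin n → ℤ} (p : Fin n) → (∀ i → i ≢ p → f i ≡ + 0) → sumFin f ≡ f p
sumFin-single {suc n} {f} zero f≡0 =
  trans (cong (_+_ (f zero)) (sumFin-zero (λ i → f≡0 (suc i) λ ()))) (ℤP.+-identityʳ _)
sumFin-single {suc n} (suc p) f≡0 =
  trans (cong₂ _+_ (f≡0 zero λ ()) (sumFin-single p (λ i i≢p → f≡0 (suc i) (i≢p ∘ suc-injective))))
        (ℤP.+-identityˡ _)

pos-sumFinℕ : ∀ {n} (f : Fin n → ℕ) → + sumFinℕ f ≡ sumFin (λ i → + f i)
pos-sumFinℕ {zero}  f = refl
pos-sumFinℕ {suc n} f = trans (ℤP.pos-+ (f zero) _) (cong (_+_ (+ f zero)) (pos-sumFinℕ (f ∘ suc)))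

δ-diag : ∀ {n} (i : Fin n) → δ i i ≡ + 1
δ-diag zero    = refl
δ-diag (suc i) = δ-diag i

δ-≢ : ∀ {n} {i j : Fin n} → i ≢ j → δ i j ≡ + 0
δ-≢ {i = zero}  {zero}  i≢j = ⊥-elim (i≢j refl)
δ-≢ {i = zero}  {suc j} i≢j = refl
δ-≢ {i = suc i} {zero}  i≢j = refl
δ-≢ {i = suc i} {suc j} i≢j = δ-≢ (i≢j ∘ cong suc)

sumFin-δ : ∀ {n} (v : Fin n) → sumFin (λ u → δ u v) ≡ + 1
sumFin-δ v = trans (sumFin-single v (λ _ → δ-≢)) (δ-diag v)

-- Determinants

minor : ∀ {n} → Mat (suc n) → Fin (suc n) → Mat n
minor M j i k = M (suc i) (punchIn j k)

laplaceTerm : ∀ {n} → Mat (suc n) → Fin (suc n) → ℤ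
laplaceTerm M j = sign (toℕ j) * M zero j * det (minor M j)

det-cong : ∀ {n} {M N : Mat n} → (∀ i j → M i j ≡ N i j) → det M ≡ det N
det-cong {zero}  M≡N = refl
det-cong {suc n} M≡N = sumFin-cong λ j →
  cong₂ (λ x y → sign (toℕ j) * x * y) (M≡N zero j) (det-cong λ i k → M≡N (suc i) (punchIn j k))

sign-suc : ∀ k → sign (suc k) ≡ - sign k
sign-suc zero          = refl
sign-suc (suc zero)    = refl
sign-suc (suc (suc k)) = sign-suc k

sign*sign≡1 : ∀ k → sign k * sign k ≡ + 1
sign*sign≡1 zero          = refl
sign*sign≡1 (suc zero)    = refl
sign*sign≡1 (suc (suc k)) = sign*sign≡1 k

det-neg : ∀ {n} (M : Mat n) → det (λ i j → - M i j) ≡ sign n * det M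
det-neg {zero}  M = refl
det-neg {suc n} M = begin
  sumFin (λ j → sign (toℕ j) * - M zero j * det (λ i k → - minor M j i k))
    ≡⟨ sumFin-cong (λ j → cong (sign (toℕ j) * - M zero j *_) (det-neg (minor M j))) ⟩
  sumFin (λ j → sign (toℕ j) * - M zero j * (sign n * det (minor M j)))
    ≡⟨ sumFin-cong (λ j → regroup (sign (toℕ j)) (M zero j) (sign n) (det (minor M j))) ⟩
  sumFin (λ j → - sign n * laplaceTerm M j)
    ≡⟨ sym (*-sumFin (- sign n) (laplaceTerm M)) ⟩
  - sign n * det M
    ≡⟨ cong (_* det M) (sym (sign-suc n)) ⟩
  sign (suc n) * det M ∎
  where
  regroup : ∀ s m s′ d → s * - m * (s′ * d) ≡ - s′ * (s * m * d)
  regroup = solve-∀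

det-rowAdditive : ∀ {n} {M N P : Mat n} (p : Fin n)
  → (∀ i → i ≢ p → M i ≗ N i) → (∀ i → i ≢ p → M i ≗ P i)
  → (∀ j → M p j ≡ N p j + P p j) → det M ≡ det N + det P
det-rowAdditive {suc n} {M} {N} {P} zero M≈N M≈P Mp =
  trans (sumFin-cong term) (sumFin-+ (laplaceTerm N) (laplaceTerm P))
  where
  distrib : ∀ s a b d → s * (a + b) * d ≡ s * a * d + s * b * d
  distrib = solve-∀
  term : ∀ j → laplaceTerm M j ≡ laplaceTerm N j + laplaceTerm P j
  term j = begin
    sign (toℕ j) * M zero j * det (minor M j)
      ≡⟨ cong (λ x → sign (toℕ j) * x * det (minor M j)) (Mp j) ⟩
    sign (toℕ j) * (N zero j + P zero j) * det (minor M j)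
      ≡⟨ distrib (sign (toℕ j)) (N zero j) (P zero j) (det (minor M j)) ⟩
    sign (toℕ j) * N zero j * det (minor M j) + sign (toℕ j) * P zero j * det (minor M j)
      ≡⟨ cong₂ (λ x y → sign (toℕ j) * N zero j * x + sign (toℕ j) * P zero j * y)
           (det-cong λ i k → M≈N (suc i) (λ ()) (punchIn j k))
           (det-cong λ i k → M≈P (suc i) (λ ()) (punchIn j k)) ⟩
    laplaceTerm N j + laplaceTerm P j ∎
det-rowAdditive {suc n} {M} {N} {P} (suc p) M≈N M≈P Mp =
  trans (sumFin-cong term) (sumFin-+ (laplaceTerm N) (laplaceTerm P))
  where
  term : ∀ j → laplaceTerm M j ≡ laplaceTerm N j + laplaceTerm P j
  term j = begin
    sign (toℕ j) * M zero j * det (minor M j)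
      ≡⟨ cong (sign (toℕ j) * M zero j *_)
           (det-rowAdditive p (λ i i≢p → M≈N (suc i) (i≢p ∘ suc-injective) ∘ punchIn j)
                              (λ i i≢p → M≈P (suc i) (i≢p ∘ suc-injective) ∘ punchIn j)
                              (Mp ∘ punchIn j)) ⟩
    sign (toℕ j) * M zero j * (det (minor N j) + det (minor P j))
      ≡⟨ ℤP.*-distribˡ-+ (sign (toℕ j) * M zero j) _ _ ⟩
    sign (toℕ j) * M zero j * det (minor N j) + sign (toℕ j) * M zero j * det (minor P j)
      ≡⟨ cong₂ (λ x y → sign (toℕ j) * x * det (minor N j) + sign (toℕ j) * y * det (minor P j))
           (M≈N zero (λ ()) j) (M≈P zero (λ ()) j) ⟩
    laplaceTerm N j + laplaceTerm P j ∎

det-rowHomogeneous : ∀ {n} {M N : Mat n} (p : Fin n) (c : ℤ)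
  → (∀ i → i ≢ p → M i ≗ N i) → (∀ j → M p j ≡ c * N p j) → det M ≡ c * det N
det-rowHomogeneous {suc n} {M} {N} zero c M≈N Mp =
  trans (sumFin-cong term) (sym (*-sumFin c (laplaceTerm N)))
  where
  regroup : ∀ s c a d → s * (c * a) * d ≡ c * (s * a * d)
  regroup = solve-∀
  term : ∀ j → laplaceTerm M j ≡ c * laplaceTerm N j
  term j = trans (cong₂ (λ x y → sign (toℕ j) * x * y) (Mp j) (det-cong λ i k → M≈N (suc i) (λ ()) (punchIn j k)))
                 (regroup (sign (toℕ j)) c (N zero j) (det (minor N j)))
det-rowHomogeneous {suc n} {M} {N} (suc p) c M≈N Mp =
  trans (sumFin-cong term) (sym (*-sumFin c (laplaceTerm N)))
  where
  regroup : ∀ s a c d → s * a * (c * d) ≡ c * (s * a * d)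
  regroup = solve-∀
  term : ∀ j → laplaceTerm M j ≡ c * laplaceTerm N j
  term j = trans (cong₂ (λ x y → sign (toℕ j) * x * y) (M≈N zero (λ ()) j)
                   (det-rowHomogeneous p c (λ i i≢p → M≈N (suc i) (i≢p ∘ suc-injective) ∘ punchIn j) (Mp ∘ punchIn j)))
                 (regroup (sign (toℕ j)) (N zero j) c (det (minor N j)))

det-zeroRow : ∀ {n} {M : Mat n} (p : Fin n) → (∀ j → M p j ≡ + 0) → det M ≡ + 0
det-zeroRow {M = M} p Mp≡0 =
  trans (det-rowHomogeneous {N = M} p (+ 0) (λ _ _ _ → refl) (λ j → trans (Mp≡0 j) (sym (ℤP.*-zeroˡ (M p j))))) refl

-- Expanding along the first row and then along the second, both equal to a, the terms
-- cancel: the j = 0 block against the k = 0 terms, and the rest is an instance one size smaller.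
doubleExpansion-vanishes : ∀ m (a : Fin (suc (suc m)) → ℤ) (F : (Fin m → Fin (suc (suc m))) → ℤ)
  → (∀ {f g} → f ≗ g → F f ≡ F g)
  → sumFin (λ j → sign (toℕ j) * a j
                  * sumFin (λ k → sign (toℕ k) * a (punchIn j k) * F (punchIn j ∘ punchIn k)))
    ≡ + 0
doubleExpansion-tail-vanishes : ∀ m (a : Fin (suc (suc m)) → ℤ) (F : (Fin m → Fin (suc (suc m))) → ℤ)
  → (∀ {f g} → f ≗ g → F f ≡ F g)
  → sumFin (λ j → sign (toℕ j) * a (suc j)
                  * sumFin (λ k → sign (toℕ (suc k)) * a (punchIn (suc j) (suc k))
                                  * F (punchIn (suc j) ∘ punchIn (suc k))))
    ≡ + 0

doubleExpansion-vanishes m a F F-cong = begin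
  + 1 * a zero * sumFin X + sumFin rowTerm
    ≡⟨ cong (_+_ (+ 1 * a zero * sumFin X)) (trans (sumFin-cong split) (sym (neg-sumFin (λ j → a zero * X j + T j)))) ⟩
  + 1 * a zero * sumFin X + - sumFin (λ j → a zero * X j + T j)
    ≡⟨ cong (λ x → + 1 * a zero * sumFin X + - x)
         (trans (sumFin-+ (λ j → a zero * X j) T)
                (cong₂ _+_ (sym (*-sumFin (a zero) X)) (doubleExpansion-tail-vanishes m a F F-cong))) ⟩
  + 1 * a zero * sumFin X + - (a zero * sumFin X + + 0)
    ≡⟨ cancel (a zero) (sumFin X) ⟩
  + 0 ∎
  where
  X : Fin (suc m) → ℤ
  X k = sign (toℕ k) * a (suc k) * F (suc ∘ punchIn k)
  Y : Fin (suc m) → ℤ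
  Y j = sumFin (λ k → sign (toℕ (suc k)) * a (punchIn (suc j) (suc k)) * F (punchIn (suc j) ∘ punchIn (suc k)))
  T : Fin (suc m) → ℤ
  T j = sign (toℕ j) * a (suc j) * Y j
  rowTerm : Fin (suc m) → ℤ
  rowTerm j = sign (toℕ (suc j)) * a (suc j) * (+ 1 * a zero * F (suc ∘ punchIn j) + Y j)
  expand : ∀ s b a₀ f y → - s * b * (+ 1 * a₀ * f + y) ≡ - (a₀ * (s * b * f) + s * b * y)
  expand = solve-∀
  split : ∀ j → rowTerm j ≡ - (a zero * X j + T j)
  split j rewrite sign-suc (toℕ j) = expand (sign (toℕ j)) (a (suc j)) (a zero) (F (suc ∘ punchIn j)) (Y j)
  cancel : ∀ a₀ x → + 1 * a₀ * x + - (a₀ * x + + 0) ≡ + 0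
  cancel = solve-∀

doubleExpansion-tail-vanishes zero    a F F-cong = sumFin-zero (λ j → ℤP.*-zeroʳ (sign (toℕ j) * a (suc j)))
doubleExpansion-tail-vanishes (suc m) a F F-cong = begin
  sumFin (λ j → sign (toℕ j) * a (suc j) * Y j)
    ≡⟨ sumFin-cong (λ j → trans (cong (sign (toℕ j) * a (suc j) *_) (Y≡-Z j))
                                (sym (ℤP.neg-distribʳ-* (sign (toℕ j) * a (suc j)) (Z j)))) ⟩
  sumFin (λ j → - (sign (toℕ j) * a (suc j) * Z j))
    ≡⟨ sym (neg-sumFin (λ j → sign (toℕ j) * a (suc j) * Z j)) ⟩
  - sumFin (λ j → sign (toℕ j) * a (suc j) * Z j)
    ≡⟨ cong -_ (doubleExpansion-vanishes m (a ∘ suc) (F ∘ lift 1)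
                  (λ f≗g → F-cong λ { zero → refl ; (suc x) → cong suc (f≗g x) })) ⟩
  + 0 ∎
  where
  Y Z : Fin (suc (suc m)) → ℤ
  Y j = sumFin (λ k → sign (toℕ (suc k)) * a (punchIn (suc j) (suc k)) * F (punchIn (suc j) ∘ punchIn (suc k)))
  Z j = sumFin (λ k → sign (toℕ k) * a (suc (punchIn j k)) * F (lift 1 (punchIn j ∘ punchIn k)))
  Y≡-Z : ∀ j → Y j ≡ - Z j
  Y≡-Z j = trans (sumFin-cong term) (sym (neg-sumFin (λ k → W k)))
    where
    W : Fin (suc m) → ℤ
    W k = sign (toℕ k) * a (suc (punchIn j k)) * F (lift 1 (punchIn j ∘ punchIn k))
    negate : ∀ s b f → - s * b * f ≡ - (s * b * f)
    negate = solve-∀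
    term : ∀ k → sign (toℕ (suc k)) * a (punchIn (suc j) (suc k)) * F (punchIn (suc j) ∘ punchIn (suc k)) ≡ - W k
    term k = trans (cong₂ (λ s f → s * a (suc (punchIn j k)) * f) (sign-suc (toℕ k))
                          (F-cong λ { zero → refl ; (suc x) → refl }))
                   (negate (sign (toℕ k)) (a (suc (punchIn j k))) (F (lift 1 (punchIn j ∘ punchIn k))))

EqualRowsVanish : ∀ {n} → Fin n → Fin n → Set
EqualRowsVanish {n} p q = ∀ (M : Mat n) → M p ≗ M q → det M ≡ + 0

equalRows01-vanish : ∀ {m} → EqualRowsVanish {suc (suc m)} zero (suc zero)
equalRows01-vanish {m} M M0≗M1 = begin
  det M
    ≡⟨ sumFin-cong (λ j → cong (sign (toℕ j) * M zero j *_) (sumFin-cong λ k →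
         cong (λ x → sign (toℕ k) * x * F (punchIn j ∘ punchIn k)) (sym (M0≗M1 (punchIn j k))))) ⟩
  sumFin (λ j → sign (toℕ j) * M zero j
                * sumFin (λ k → sign (toℕ k) * M zero (punchIn j k) * F (punchIn j ∘ punchIn k)))
    ≡⟨ doubleExpansion-vanishes m (M zero) F (λ f≗g → det-cong λ i k → cong (M (suc (suc i))) (f≗g k)) ⟩
  + 0 ∎
  where
  F : (Fin m → Fin (suc (suc m))) → ℤ
  F f = det (λ i k → M (suc (suc i)) (f k))

equalRows-vanish-suc : ∀ {n} {p q : Fin n} → EqualRowsVanish p q → EqualRowsVanish (suc p) (suc q)
equalRows-vanish-suc vanish M Mp≗Mq =
  sumFin-zero λ j → trans (cong (sign (toℕ j) * M zero j *_) (vanish (minor M j) (Mp≗Mq ∘ punchIn j)))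
                          (ℤP.*-zeroʳ (sign (toℕ j) * M zero j))

setRow : ∀ {n} → Mat n → Fin n → (Fin n → ℤ) → Mat n
setRow M p u = updateAt M p (const u)

setRow-≡ : ∀ {n} (M : Mat n) p u → setRow M p u p ≗ u
setRow-≡ M p u = cong-app (updateAt-updates p M)

setRow-≢ : ∀ {n} (M : Mat n) {p i} u → i ≢ p → setRow M p u i ≗ M i
setRow-≢ M {p} {i} u i≢p = cong-app (updateAt-minimal i p M i≢p)

setRow-self : ∀ {n} (M : Mat n) p i → setRow M p (M p) i ≗ M i
setRow-self M p i with i ≟ p
... | yes refl = setRow-≡ M p (M p)
... | no i≢p   = setRow-≢ M (M p) i≢p

-- Bilinearity in rows p and q, with S = Mp + Mq:
-- 0 = det(S, S) = det(Mp, Mp) + det(Mp, Mq) + det(Mq, Mp) + det(Mq, Mq).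
det-swapRows : ∀ {n} {p q : Fin n} → p ≢ q → EqualRowsVanish p q → (M : Mat n)
  → det (setRow (setRow M q (M p)) p (M q)) ≡ - det M
det-swapRows {n} {p} {q} p≢q vanish M = inverseʳ-unique (det M) (det (R (M q) (M p))) (sym (begin
  + 0
    ≡⟨ sym (vanishR S) ⟩
  det (R S S)
    ≡⟨ additive-p (M p) (M q) S ⟩
  det (R (M p) S) + det (R (M q) S)
    ≡⟨ cong₂ _+_ (additive-q (M p) (M p) (M q)) (additive-q (M q) (M p) (M q)) ⟩
  (det (R (M p) (M p)) + det (R (M p) (M q))) + (det (R (M q) (M p)) + det (R (M q) (M q)))
    ≡⟨ cong₂ (λ x y → (x + det (R (M p) (M q))) + (det (R (M q) (M p)) + y)) (vanishR (M p)) (vanishR (M q)) ⟩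
  (+ 0 + det (R (M p) (M q))) + (det (R (M q) (M p)) + + 0)
    ≡⟨ cong (λ x → (+ 0 + x) + (det (R (M q) (M p)) + + 0)) (det-cong R-Mp-Mq) ⟩
  (+ 0 + det M) + (det (R (M q) (M p)) + + 0)
    ≡⟨ drop0 (det M) (det (R (M q) (M p))) ⟩
  det M + det (R (M q) (M p)) ∎))
  where
  R : (Fin n → ℤ) → (Fin n → ℤ) → Mat n
  R u v = setRow (setRow M q v) p u
  S : Fin n → ℤ
  S j = M p j + M q j
  q≢p : q ≢ p
  q≢p = p≢q ∘ sym
  R-q : ∀ u v → R u v q ≗ v
  R-q u v j = trans (setRow-≢ (setRow M q v) u q≢p j) (setRow-≡ M q v j)
  R-offq : ∀ u v v′ i → i ≢ q → R u v i ≗ R u v′ i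
  R-offq u v v′ i i≢q with i ≟ p
  ... | yes refl = λ j → trans (setRow-≡ _ p u j) (sym (setRow-≡ _ p u j))
  ... | no i≢p   = λ j → trans (setRow-≢ _ u i≢p j) (trans (setRow-≢ M v i≢q j)
                          (sym (trans (setRow-≢ _ u i≢p j) (setRow-≢ M v′ i≢q j))))
  vanishR : ∀ u → det (R u u) ≡ + 0
  vanishR u = vanish (R u u) (λ j → trans (setRow-≡ _ p u j) (sym (R-q u u j)))
  additive-p : ∀ u u′ v → det (R (λ j → u j + u′ j) v) ≡ det (R u v) + det (R u′ v)
  additive-p u u′ v = det-rowAdditive p
    (λ i i≢p j → trans (setRow-≢ _ _ i≢p j) (sym (setRow-≢ _ _ i≢p j)))
    (λ i i≢p j → trans (setRow-≢ _ _ i≢p j) (sym (setRow-≢ _ _ i≢p j)))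
    (λ j → trans (setRow-≡ _ p _ j) (sym (cong₂ _+_ (setRow-≡ _ p u j) (setRow-≡ _ p u′ j))))
  additive-q : ∀ u v v′ → det (R u (λ j → v j + v′ j)) ≡ det (R u v) + det (R u v′)
  additive-q u v v′ = det-rowAdditive q (λ i → R-offq u _ v i) (λ i → R-offq u _ v′ i)
    (λ j → trans (R-q u _ j) (sym (cong₂ _+_ (R-q u v j) (R-q u v′ j))))
  R-Mp-Mq : ∀ i → R (M p) (M q) i ≗ M i
  R-Mp-Mq i with i ≟ p
  ... | yes refl = setRow-≡ _ p (M p)
  ... | no i≢p   = λ j → trans (setRow-≢ _ (M p) i≢p j) (setRow-self M q i j)
  drop0 : ∀ a b → (+ 0 + a) + (b + + 0) ≡ a + b
  drop0 = solve-∀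

-- Rows 0 and q + 2 are reduced to rows 0 and 1 by swapping rows 1 and q + 2.
equalRows0-vanish : ∀ {m} (q : Fin (suc m)) → EqualRowsVanish {suc (suc m)} zero (suc q)
equalRows0-vanish zero = equalRows01-vanish
equalRows0-vanish {suc m} (suc q) M M0≗Mq = begin
  det M          ≡⟨ sym (ℤP.neg-involutive (det M)) ⟩
  - - det M      ≡⟨ cong -_ (sym (det-swapRows (λ ()) (equalRows-vanish-suc (equalRows0-vanish q)) M)) ⟩
  - det swapped  ≡⟨ cong -_ (equalRows01-vanish swapped M0≗Mq) ⟩
  + 0 ∎
  where
  swapped : Mat (suc (suc (suc m)))
  swapped = setRow (setRow M (suc (suc q)) (M (suc zero))) (suc zero) (M (suc (suc q)))

equalRows-vanish : ∀ {n} {p q : Fin n} → p ≢ q → EqualRowsVanish p q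
equalRows-vanish {suc n}       {zero}  {zero}  p≢q = ⊥-elim (p≢q refl)
equalRows-vanish {suc (suc m)} {zero}  {suc q} _   = equalRows0-vanish q
equalRows-vanish {suc (suc m)} {suc p} {zero}  _   M Mp≗M0 = equalRows0-vanish p M (sym ∘ Mp≗M0)
equalRows-vanish {suc n}       {suc p} {suc q} p≢q = equalRows-vanish-suc (equalRows-vanish (p≢q ∘ cong suc))

det-setRow-sum : ∀ {n k} (M : Mat n) (p : Fin n) (V : Fin k → Fin n → ℤ)
  → det (setRow M p (λ j → sumFin (λ i → V i j))) ≡ sumFin (λ i → det (setRow M p (V i)))
det-setRow-sum {k = zero}  M p V = det-zeroRow p (setRow-≡ M p (const (+ 0)))
det-setRow-sum {k = suc k} M p V = trans
  (det-rowAdditive p (offRow _ _) (offRow _ _)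
    (λ j → trans (setRow-≡ M p _ j) (sym (cong₂ _+_ (setRow-≡ M p (V zero) j) (setRow-≡ M p _ j)))))
  (cong (_+_ (det (setRow M p (V zero)))) (det-setRow-sum M p (V ∘ suc)))
  where
  offRow : ∀ u v i → i ≢ p → setRow M p u i ≗ setRow M p v i
  offRow u v i i≢p j = trans (setRow-≢ M u i≢p j) (sym (setRow-≢ M v i≢p j))

det-setRow-columnSums : ∀ {n} (M : Mat n) (p : Fin n) → det (setRow M p (λ j → sumFin (λ i → M i j))) ≡ det M
det-setRow-columnSums M p = begin
  det (setRow M p (λ j → sumFin (λ i → M i j)))  ≡⟨ det-setRow-sum M p M ⟩
  sumFin (λ i → det (setRow M p (M i)))           ≡⟨ sumFin-single p otherRows-vanish ⟩
  det (setRow M p (M p))                          ≡⟨ det-cong (setRow-self M p) ⟩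
  det M ∎
  where
  otherRows-vanish : ∀ i → i ≢ p → det (setRow M p (M i)) ≡ + 0
  otherRows-vanish i i≢p = equalRows-vanish (i≢p ∘ sym) (setRow M p (M i))
    (λ j → trans (setRow-≡ M p (M i) j) (sym (setRow-≢ M (M i) i≢p j)))

det-constantColumnSums : ∀ {n} (M : Mat n) (p : Fin n) (s : ℤ) → (∀ j → sumFin (λ i → M i j) ≡ s)
  → det M ≡ s * det (setRow M p (const (+ 1)))
det-constantColumnSums M p s colSum = trans (sym (det-setRow-columnSums M p))
  (det-rowHomogeneous p s
    (λ i i≢p j → trans (setRow-≢ M _ i≢p j) (sym (setRow-≢ M (const (+ 1)) i≢p j)))
    (λ j → trans (setRow-≡ M p _ j)
           (trans (colSum j) (trans (sym (ℤP.*-identityʳ s)) (cong (s *_) (sym (setRow-≡ M p (const (+ 1)) j)))))))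

det-addRowMultiple : ∀ {n} (M : Mat n) {i p : Fin n} → i ≢ p → (a : ℤ)
  → det (setRow M i (λ j → M i j + a * M p j)) ≡ det M
det-addRowMultiple M {i} {p} i≢p a = begin
  det (setRow M i (λ j → M i j + a * M p j))
    ≡⟨ det-rowAdditive i (λ k k≢i → setRow-≢ M _ k≢i)
         (λ k k≢i j → trans (setRow-≢ M _ k≢i j) (sym (setRow-≢ M _ k≢i j)))
         (λ j → trans (setRow-≡ M i _ j) (cong (_+_ (M i j)) (sym (setRow-≡ M i _ j)))) ⟩
  det M + det (setRow M i (λ j → a * M p j))
    ≡⟨ cong (_+_ (det M)) (det-rowHomogeneous i a
         (λ k k≢i j → trans (setRow-≢ M _ k≢i j) (sym (setRow-≢ M (M p) k≢i j)))
         (λ j → trans (setRow-≡ M i _ j) (cong (a *_) (sym (setRow-≡ M i (M p) j))))) ⟩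
  det M + a * det (setRow M i (M p))
    ≡⟨ cong (λ x → det M + a * x) (equalRows-vanish i≢p (setRow M i (M p))
         (λ j → trans (setRow-≡ M i (M p) j) (sym (setRow-≢ M (M p) (i≢p ∘ sym) j)))) ⟩
  det M + a * + 0
    ≡⟨ cong (_+_ (det M)) (ℤP.*-zeroʳ a) ⟩
  det M + + 0
    ≡⟨ ℤP.+-identityʳ (det M) ⟩
  det M ∎

-- Proved by adding the multiples one row at a time: `go k` handles coefficient vectors
-- that vanish from row k on.
det-addRowMultiples : ∀ {n} (M : Mat n) (p : Fin n) (c : Fin n → ℤ) → c p ≡ + 0
  → det (λ i j → M i j + c i * M p j) ≡ det M
det-addRowMultiples {n} M p c cp≡0 = go n c cp≡0 (λ i n≤i → ⊥-elim (ℕP.<⇒≱ (toℕ<n i) n≤i))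
  where
  addMultiples : (Fin n → ℤ) → Mat n
  addMultiples c i j = M i j + c i * M p j
  go : ∀ k (c : Fin n → ℤ) → c p ≡ + 0 → (∀ i → k ℕ.≤ toℕ i → c i ≡ + 0) → det (addMultiples c) ≡ det M
  go zero c _ c≡0 = det-cong λ i j →
    trans (cong (λ x → M i j + x * M p j) (c≡0 i ℕ.z≤n))
          (trans (cong (_+_ (M i j)) (ℤP.*-zeroˡ (M p j))) (ℤP.+-identityʳ (M i j)))
  go (suc k) c cp≡0 c≡0 with k ℕ.<? n
  ... | no k≮n = go k c cp≡0 (λ i k≤i → ⊥-elim (k≮n (ℕP.≤-<-trans k≤i (toℕ<n i))))
  ... | yes k<n with fromℕ< k<n ≟ p
  ...   | yes i₀≡p = go k c cp≡0 c≡0-from-k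
    where
    c≡0-from-k : ∀ i → k ℕ.≤ toℕ i → c i ≡ + 0
    c≡0-from-k i k≤i with ℕP.m≤n⇒m<n∨m≡n k≤i
    ... | inj₁ k<i = c≡0 i k<i
    ... | inj₂ k≡i = trans (cong c (toℕ-injective (trans (sym k≡i) (sym (toℕ-fromℕ< k<n)))))
                           (trans (cong c i₀≡p) cp≡0)
  ...   | no i₀≢p = begin
    det (addMultiples c)                    ≡⟨ det-cong split ⟩
    det (setRow (addMultiples c′) i₀ (λ j → addMultiples c′ i₀ j + c i₀ * addMultiples c′ p j))
                                            ≡⟨ det-addRowMultiple (addMultiples c′) i₀≢p (c i₀) ⟩
    det (addMultiples c′)                   ≡⟨ go k c′ c′p≡0 c′≡0 ⟩
    det M ∎
    where
    i₀ = fromℕ< k<n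
    c′ : Fin n → ℤ
    c′ = updateAt c i₀ (const (+ 0))
    c′p≡0 : c′ p ≡ + 0
    c′p≡0 = trans (updateAt-minimal p i₀ c (i₀≢p ∘ sym)) cp≡0
    c′≡0 : ∀ i → k ℕ.≤ toℕ i → c′ i ≡ + 0
    c′≡0 i k≤i with ℕP.m≤n⇒m<n∨m≡n k≤i
    ... | inj₁ k<i = trans (updateAt-minimal i i₀ c (λ { refl → ℕP.<-irrefl (sym (toℕ-fromℕ< k<n)) k<i })) (c≡0 i k<i)
    ... | inj₂ k≡i rewrite toℕ-injective (trans (sym k≡i) (sym (toℕ-fromℕ< k<n))) = updateAt-updates i₀ c
    rearrange : ∀ m a x → m + a * x ≡ (m + + 0 * x) + a * (x + + 0 * x)
    rearrange = solve-∀
    split : ∀ i j → addMultiples c i j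
                  ≡ setRow (addMultiples c′) i₀ (λ j → addMultiples c′ i₀ j + c i₀ * addMultiples c′ p j) i j
    split i j with i ≟ i₀
    ... | yes refl = begin
      M i₀ j + c i₀ * M p j
        ≡⟨ rearrange (M i₀ j) (c i₀) (M p j) ⟩
      (M i₀ j + + 0 * M p j) + c i₀ * (M p j + + 0 * M p j)
        ≡⟨ cong₂ (λ x y → (M i₀ j + x * M p j) + c i₀ * (M p j + y * M p j))
                 (sym (updateAt-updates i₀ c)) (sym c′p≡0) ⟩
      addMultiples c′ i₀ j + c i₀ * addMultiples c′ p j
        ≡⟨ sym (setRow-≡ (addMultiples c′) i₀ _ j) ⟩
      _ ∎
    ... | no i≢i₀ = trans (cong (λ x → M i j + x * M p j) (sym (updateAt-minimal i i₀ c i≢i₀)))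
                          (sym (setRow-≢ (addMultiples c′) _ i≢i₀ j))

det-addConstant : ∀ {m} (M : Mat (suc m)) (r c : ℤ) → (∀ j → sumFin (λ i → M i j) ≡ r)
  → r * det (λ i j → M i j + c) ≡ (r + c * + suc m) * det M
det-addConstant {m} M r c colSum = begin
  r * det Y                                 ≡⟨ cong (r *_) (det-constantColumnSums Y zero r′ colSumY) ⟩
  r * (r′ * det (setRow Y zero one))        ≡⟨ cong (λ x → r * (r′ * x)) shiftRows ⟩
  r * (r′ * det (setRow M zero one))        ≡⟨ swap r r′ _ ⟩
  r′ * (r * det (setRow M zero one))        ≡⟨ cong (r′ *_) (sym (det-constantColumnSums M zero r colSum)) ⟩
  r′ * det M ∎
  where
  Y : Mat (suc m)
  Y i j = M i j + c
  r′ = r + c * + suc m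
  one : Fin (suc m) → ℤ
  one = const (+ 1)
  colSumY : ∀ j → sumFin (λ i → Y i j) ≡ r′
  colSumY j = trans (sumFin-+ (λ i → M i j) (const c)) (cong₂ _+_ (colSum j) (sumFin-const (suc m) c))
  swap : ∀ a b d → a * (b * d) ≡ b * (a * d)
  swap = solve-∀
  c′ : Fin (suc m) → ℤ
  c′ zero    = + 0
  c′ (suc _) = c
  shiftRows : det (setRow Y zero one) ≡ det (setRow M zero one)
  shiftRows = trans (det-cong pointwise) (det-addRowMultiples (setRow M zero one) zero c′ refl)
    where
    pointwise : ∀ i j → setRow Y zero one i j ≡ setRow M zero one i j + c′ i * + 1
    pointwise zero    j = refl
    pointwise (suc i) j = cong (_+_ (M (suc i) j)) (sym (ℤP.*-identityʳ c))

-- Polynomial functions on ℤ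

Deg< : ℕ → (ℤ → ℤ) → Set
Deg< zero    f = ∀ t → f t ≡ + 0
Deg< (suc d) f = Σ ℤ λ c → Σ (ℤ → ℤ) λ g → Deg< d g × (∀ t → f t ≡ c + t * g t)

Deg<-resp-≗ : ∀ d {f g} → Deg< d f → f ≗ g → Deg< d g
Deg<-resp-≗ zero    f≡0 f≗g t = trans (sym (f≗g t)) (f≡0 t)
Deg<-resp-≗ (suc d) (c , h , deg-h , f≡) f≗g = c , h , deg-h , (λ t → trans (sym (f≗g t)) (f≡ t))

c≡c+t*0 : ∀ c t → c ≡ c + t * + 0
c≡c+t*0 c t = sym (trans (cong (_+_ c) (ℤP.*-zeroʳ t)) (ℤP.+-identityʳ c))

Deg<-zero : ∀ d → Deg< d (const (+ 0))
Deg<-zero zero    t = refl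
Deg<-zero (suc d) = + 0 , const (+ 0) , Deg<-zero d , c≡c+t*0 (+ 0)

Deg<-suc : ∀ d {f} → Deg< d f → Deg< (suc d) f
Deg<-suc zero    f≡0                 = + 0 , const (+ 0) , (λ _ → refl) , (λ t → trans (f≡0 t) (c≡c+t*0 (+ 0) t))
Deg<-suc (suc d) (c , g , deg-g , f≡) = c , g , Deg<-suc d deg-g , f≡

Deg<-+ℕ : ∀ k d {f} → Deg< d f → Deg< (k ℕ.+ d) f
Deg<-+ℕ zero    d deg-f = deg-f
Deg<-+ℕ (suc k) d deg-f = Deg<-suc (k ℕ.+ d) (Deg<-+ℕ k d deg-f)

Deg<-const : ∀ c → Deg< 1 (const c)
Deg<-const c = c , const (+ 0) , (λ _ → refl) , c≡c+t*0 c

Deg<-+ : ∀ d {f g} → Deg< d f → Deg< d g → Deg< d (λ t → f t + g t)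
Deg<-+ zero    f≡0 g≡0 t = cong₂ _+_ (f≡0 t) (g≡0 t)
Deg<-+ (suc d) (c , f′ , deg-f′ , f≡) (c′ , g′ , deg-g′ , g≡) =
  c + c′ , (λ t → f′ t + g′ t) , Deg<-+ d deg-f′ deg-g′ ,
  (λ t → trans (cong₂ _+_ (f≡ t) (g≡ t)) (collect c c′ t (f′ t) (g′ t)))
  where
  collect : ∀ c c′ t x y → c + t * x + (c′ + t * y) ≡ c + c′ + t * (x + y)
  collect = solve-∀

Deg<-scale : ∀ d a {f} → Deg< d f → Deg< d (λ t → a * f t)
Deg<-scale zero    a f≡0 t = trans (cong (a *_) (f≡0 t)) (ℤP.*-zeroʳ a)
Deg<-scale (suc d) a (c , g , deg-g , f≡) =
  a * c , (λ t → a * g t) , Deg<-scale d a deg-g , (λ t → trans (cong (a *_) (f≡ t)) (distrib a c t (g t)))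
  where
  distrib : ∀ a c t x → a * (c + t * x) ≡ a * c + t * (a * x)
  distrib = solve-∀

Deg<-- : ∀ d {f g} → Deg< d f → Deg< d g → Deg< d (λ t → f t - g t)
Deg<-- d {g = g} deg-f deg-g =
  Deg<-+ d deg-f (Deg<-resp-≗ d (Deg<-scale d (- + 1) deg-g) (ℤP.-1*i≡-i ∘ g))

Deg<-*t : ∀ d {g} → Deg< d g → Deg< (suc d) (λ t → t * g t)
Deg<-*t d {g} deg-g = + 0 , g , deg-g , (λ t → sym (ℤP.+-identityˡ (t * g t)))

Deg<-* : ∀ a b {f g} → Deg< a f → Deg< (suc b) g → Deg< (a ℕ.+ b) (λ t → f t * g t)
Deg<-* zero    b {g = g} f≡0 deg-g =
  Deg<-resp-≗ b (Deg<-zero b) (λ t → sym (trans (cong (_* g t) (f≡0 t)) (ℤP.*-zeroˡ (g t))))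
Deg<-* (suc a) b {f} {g} (c , f′ , deg-f′ , f≡) deg-g = Deg<-resp-≗ (suc (a ℕ.+ b))
  (Deg<-+ (suc (a ℕ.+ b))
    (subst (λ e → Deg< e (λ t → c * g t)) (ℕP.+-suc a b) (Deg<-+ℕ a (suc b) (Deg<-scale (suc b) c deg-g)))
    (Deg<-*t (a ℕ.+ b) (Deg<-* a b deg-f′ deg-g)))
  (λ t → sym (trans (cong (_* g t) (f≡ t)) (distrib c t (f′ t) (g t))))
  where
  distrib : ∀ c t x y → (c + t * x) * y ≡ c * y + t * (x * y)
  distrib = solve-∀

Deg<-sum : ∀ d {k} (F : ℤ → Fin k → ℤ) → (∀ j → Deg< d (λ t → F t j)) → Deg< d (λ t → sumFin (F t))
Deg<-sum d {zero}  F deg-F = Deg<-zero d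
Deg<-sum d {suc k} F deg-F = Deg<-+ d (deg-F zero) (Deg<-sum d (λ t j → F t (suc j)) (deg-F ∘ suc))

Deg<-^ : ∀ m → Deg< (suc m) (λ t → t ^ m)
Deg<-^ zero    = Deg<-const (+ 1)
Deg<-^ (suc m) = Deg<-*t (suc m) (Deg<-^ m)

Deg<-affine : ∀ (u a : ℤ) → Deg< 2 (λ t → t * u - a)
Deg<-affine u a = - a , const u , Deg<-const u , (λ t → ℤP.+-comm (t * u) (- a))

Deg<-affine-0 : ∀ {u} a → u ≡ + 0 → Deg< 1 (λ t → t * u - a)
Deg<-affine-0 a refl = Deg<-resp-≗ 1 (Deg<-const (- a))
  (λ t → sym (trans (cong (_- a) (ℤP.*-zeroʳ t)) (ℤP.+-identityˡ (- a))))

c+T*x≡0⇒c≡0 : ∀ (c x : ℤ) (T : ℕ) → ∣ c ∣ ℕ.< T → c + + T * x ≡ + 0 → c ≡ + 0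
c+T*x≡0⇒c≡0 c x T |c|<T c+Tx≡0 = by-size ∣ x ∣ refl
  where
  c≡-Tx : c ≡ - (+ T * x)
  c≡-Tx = inverseˡ-unique c _ c+Tx≡0
  by-size : ∀ n → ∣ x ∣ ≡ n → c ≡ + 0
  by-size zero    |x|≡0 =
    trans c≡-Tx (trans (cong (λ y → - (+ T * y)) (ℤP.∣i∣≡0⇒i≡0 |x|≡0)) (cong -_ (ℤP.*-zeroʳ (+ T))))
  by-size (suc k) |x|≡ = ⊥-elim (ℕP.<⇒≱ |c|<T (subst (T ℕ.≤_) (sym |c|≡) (ℕP.m≤m*n T (suc k))))
    where
    |c|≡ : ∣ c ∣ ≡ T ℕ.* suc k
    |c|≡ = trans (cong ∣_∣ c≡-Tx) (trans (ℤP.∣-i∣≡∣i∣ (+ T * x)) (trans (ℤP.abs-* (+ T) x) (cong (T ℕ.*_) |x|≡)))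

-- A polynomial function vanishing at all large integers vanishes: its constant term c is
-- divisible by arbitrarily large integers T, so c = 0, and the quotient vanishes at the same points.
Deg<-vanishingBeyond : ∀ d {f} → Deg< d f → (B : ℕ) → (∀ T → B ℕ.< T → f (+ T) ≡ + 0) → ∀ t → f t ≡ + 0
Deg<-vanishingBeyond zero    f≡0 B _ = f≡0
Deg<-vanishingBeyond (suc d) {f} (c , g , deg-g , f≡) B f≡0 t = begin
  f t           ≡⟨ f≡ t ⟩
  c + t * g t   ≡⟨ cong₂ (λ x y → x + t * y) c≡0 (Deg<-vanishingBeyond d deg-g B g≡0 t) ⟩
  + 0 + t * + 0 ≡⟨ sym (c≡c+t*0 (+ 0) t) ⟩
  + 0 ∎
  where
  T₀ = B ℕ.+ suc ∣ c ∣
  c≡0 : c ≡ + 0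
  c≡0 = c+T*x≡0⇒c≡0 c (g (+ T₀)) T₀ (ℕP.m≤n+m (suc ∣ c ∣) B)
          (trans (sym (f≡ (+ T₀))) (f≡0 T₀ (ℕP.m<m+n B ℕ.z<s)))
  g≡0 : ∀ T → B ℕ.< T → g (+ T) ≡ + 0
  g≡0 T B<T with ℤP.i*j≡0⇒i≡0∨j≡0 (+ T)
                   (trans (sym (ℤP.+-identityˡ _)) (trans (cong (λ x → x + _) (sym c≡0)) (trans (sym (f≡ _)) (f≡0 T B<T))))
  ... | inj₂ g≡0 = g≡0
  ... | inj₁ T≡0 = ⊥-elim (ℕP.n≮0 (subst (B ℕ.<_) (ℤP.+-injective T≡0) B<T))

Deg<-cancelLinear : ∀ d {h} → Deg< d h → (a : ℤ) → (∀ t → (t + a) * h t ≡ + 0) → ∀ t → h t ≡ + 0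
Deg<-cancelLinear d {h} deg-h a h-root = Deg<-vanishingBeyond d deg-h ∣ a ∣ h≡0
  where
  h≡0 : ∀ T → ∣ a ∣ ℕ.< T → h (+ T) ≡ + 0
  h≡0 T |a|<T with ℤP.i*j≡0⇒i≡0∨j≡0 (+ T + a) (h-root (+ T))
  ... | inj₂ h≡0   = h≡0
  ... | inj₁ T+a≡0 = ⊥-elim (ℕP.<-irrefl (trans (cong ∣_∣ a≡-T) (ℤP.∣-i∣≡∣i∣ (+ T))) |a|<T)
    where
    a≡-T : a ≡ - + T
    a≡-T = inverseˡ-unique a (+ T) (trans (ℤP.+-comm a (+ T)) T+a≡0)

cancelLinearFactor : ∀ d {f g} → Deg< d f → Deg< d g → (a : ℤ)
  → (∀ t → (t + a) * f t ≡ (t + a) * g t) → f ≗ g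
cancelLinearFactor d {f} {g} deg-f deg-g a eq t = ℤP.i-j≡0⇒i≡j (f t) (g t)
  (Deg<-cancelLinear d (Deg<-- d deg-f deg-g) a
    (λ t → trans (ℤP.*-distribˡ-+ (t + a) (f t) (- g t))
           (trans (cong (_+_ ((t + a) * f t)) (sym (ℤP.neg-distribʳ-* (t + a) (g t))))
           (trans (cong (λ x → x - (t + a) * g t) (eq t)) (ℤP.+-inverseʳ ((t + a) * g t))))) t)

leadingCoefficient-vanishes : ∀ m c {r} → Deg< m r → (∀ t → c * t ^ m + r t ≡ + 0) → c ≡ + 0
leadingCoefficient-vanishes zero c r≡0 eq = trans (sym (ℤP.*-identityʳ c)) (trans (sym (ℤP.+-identityʳ (c * + 1)))
  (trans (cong (_+_ (c * + 1)) (sym (r≡0 (+ 0)))) (eq (+ 0))))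
leadingCoefficient-vanishes (suc m) c {r} (r₀ , r′ , deg-r′ , r≡) eq =
  leadingCoefficient-vanishes m c deg-r′ (Deg<-vanishingBeyond (suc m) deg-q 0 q≡0)
  where
  at0 : ∀ c x r y → c * (+ 0 * x) + (r + + 0 * y) ≡ r
  at0 = solve-∀
  r₀≡0 : r₀ ≡ + 0
  r₀≡0 = trans (sym (at0 c ((+ 0) ^ m) r₀ (r′ (+ 0)))) (trans (cong (_+_ (c * (+ 0 * (+ 0) ^ m))) (sym (r≡ (+ 0)))) (eq (+ 0)))
  q : ℤ → ℤ
  q t = c * t ^ m + r′ t
  deg-q : Deg< (suc m) q
  deg-q = Deg<-+ (suc m) (Deg<-scale (suc m) c (Deg<-^ m)) (Deg<-suc m deg-r′)
  factor : ∀ t c x r y → t * (c * x + y) ≡ c * (t * x) + (r + t * y) - r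
  factor = solve-∀
  q≡0 : ∀ T → 0 ℕ.< T → q (+ T) ≡ + 0
  q≡0 (suc k) _ with ℤP.i*j≡0⇒i≡0∨j≡0 (+ suc k) {q (+ suc k)}
               (trans (factor (+ suc k) c ((+ suc k) ^ m) r₀ (r′ (+ suc k)))
                 (trans (cong (λ x → c * (+ suc k * (+ suc k) ^ m) + x - r₀) (sym (r≡ (+ suc k))))
                   (trans (cong (_- r₀) (eq (+ suc k))) (cong (λ x → + 0 - x) r₀≡0))))
  ... | inj₁ ()
  ... | inj₂ q≡0 = q≡0

-- Characteristic polynomials

det-Deg< : ∀ {m} (N : ℤ → Mat m) (e : Fin m → ℕ) → (∀ i j → Deg< (suc (e i)) (λ t → N t i j))
  → Deg< (suc (sumFinℕ e)) (λ t → det (N t))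
det-Deg< {zero}  N e deg-N = Deg<-const (+ 1)
det-Deg< {suc m} N e deg-N = Deg<-sum (suc (sumFinℕ e)) (λ t → laplaceTerm (N t)) λ j →
  Deg<-* (suc (e zero)) (sumFinℕ (e ∘ suc))
    (Deg<-scale (suc (e zero)) (sign (toℕ j)) (deg-N zero j))
    (det-Deg< (λ t → minor (N t) j) (e ∘ suc) (λ i k → deg-N (suc i) (punchIn j k)))

sumFinℕ-ones : ∀ n → sumFinℕ {n} (const 1) ≡ n
sumFinℕ-ones zero    = refl
sumFinℕ-ones (suc n) = cong suc (sumFinℕ-ones n)

sumFinℕ-onesExcept : ∀ {n} (j : Fin (suc n)) → sumFinℕ (λ i → if does (i ≟ j) then 0 else 1) ≡ n
sumFinℕ-onesExcept {n}     zero    = sumFinℕ-ones n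
sumFinℕ-onesExcept {suc n} (suc j) = cong suc (sumFinℕ-onesExcept j)

charPolyAt-Deg< : ∀ {n} (M : Mat n) → Deg< (suc n) (charPolyAt M)
charPolyAt-Deg< {n} M = subst (λ d → Deg< (suc d) (charPolyAt M)) (sumFinℕ-ones n)
  (det-Deg< (λ t → (t · I) ⊖ M) (const 1) (λ i j → Deg<-affine (δ i j) (M i j)))

trace : ∀ {n} → Mat n → ℤ
trace M = sumFin (λ i → M i i)

δ-punchIn : ∀ {n} (i : Fin (suc n)) k → δ i (punchIn i k) ≡ + 0
δ-punchIn zero            k       = refl
δ-punchIn {suc n} (suc i) zero    = refl
δ-punchIn {suc n} (suc i) (suc k) = δ-punchIn i k

-- Expanding along the first row, only the (0,0) term t - M₀₀ times the characteristic polynomial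
-- of the lower-right block reaches degree n - 1: every other minor has a row free of t.
charPolyAt-leadingTerms : ∀ n (M : Mat (suc n))
  → Deg< n (λ t → charPolyAt M t - (t ^ suc n - trace M * t ^ n))
charPolyAt-leadingTerms zero M t = constant t (M zero zero)
  where
  constant : ∀ t a → + 1 * (t * + 1 - a) * + 1 + + 0 - (t * + 1 - (a + + 0) * + 1) ≡ + 0
  constant = solve-∀
charPolyAt-leadingTerms (suc n) M =
  Deg<-resp-≗ (suc n) deg-expansion (λ t → sym (regroup t a (trace M′) (t ^ n) (charPolyAt M′ t) (otherTerms t)))
  where
  M′ : Mat (suc n)
  M′ i k = M (suc i) (suc k)
  a = M zero zero
  C : ℤ → Mat (suc (suc n))
  C t = (t · I) ⊖ M
  otherTerms : ℤ → ℤ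
  otherTerms t = sumFin (λ j → laplaceTerm (C t) (suc j))
  remainder′ : ℤ → ℤ
  remainder′ t = charPolyAt M′ t - (t ^ suc n - trace M′ * t ^ n)
  regroup : ∀ t a T X P r → + 1 * (t * + 1 - a) * P + r - (t * (t * X) - (a + T) * (t * X))
                          ≡ a * T * X + (t - a) * (P - (t * X - T * X)) + r
  regroup = solve-∀
  deg-leading : Deg< (suc n) (λ t → (t - a) * remainder′ t)
  deg-leading = Deg<-resp-≗ (suc n)
    (subst (λ d → Deg< d (λ t → remainder′ t * (t * + 1 - a))) (ℕP.+-comm n 1)
      (Deg<-* n 1 (charPolyAt-leadingTerms n M′) (Deg<-affine (+ 1) a)))
    (λ t → trans (ℤP.*-comm (remainder′ t) _) (cong (λ x → (x - a) * remainder′ t) (ℤP.*-identityʳ t)))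
  minorRowDegree : ∀ j i → ℕ
  minorRowDegree j i = if does (i ≟ j) then 0 else 1
  deg-minor : ∀ j i k → Deg< (suc (minorRowDegree j i)) (λ t → minor (C t) (suc j) i k)
  deg-minor j i k with i ≟ j
  ... | yes refl = Deg<-affine-0 (M (suc i) (punchIn (suc i) k)) (δ-punchIn (suc i) k)
  ... | no _     = Deg<-affine _ _
  deg-otherTerms : Deg< (suc n) otherTerms
  deg-otherTerms = Deg<-sum (suc n) _ λ j → Deg<-* 1 n
    (Deg<-scale 1 (sign (toℕ (suc j))) (Deg<-affine-0 (M zero (suc j)) refl))
    (subst (λ d → Deg< (suc d) (λ t → det (minor (C t) (suc j)))) (sumFinℕ-onesExcept j)
      (det-Deg< (λ t → minor (C t) (suc j)) (minorRowDegree j) (deg-minor j)))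
  deg-expansion : Deg< (suc n) (λ t → a * trace M′ * t ^ n + (t - a) * remainder′ t + otherTerms t)
  deg-expansion = Deg<-+ (suc n) (Deg<-+ (suc n) (Deg<-scale (suc n) (a * trace M′) (Deg<-^ n)) deg-leading) deg-otherTerms

Cospectral⇒trace≡ : ∀ {n} (M N : Mat (suc n)) → Cospectral M N → trace M ≡ trace N
Cospectral⇒trace≡ {n} M N cospectral = sym (ℤP.i-j≡0⇒i≡j (trace N) (trace M)
  (leadingCoefficient-vanishes n (trace N - trace M)
    (Deg<-- n (charPolyAt-leadingTerms n M) (charPolyAt-leadingTerms n N))
    (λ t → trans (regroup (charPolyAt M t) (charPolyAt N t) (trace M) (trace N) (t ^ suc n) (t ^ n))
             (trans (cong (_- charPolyAt N t) (cospectral t)) (ℤP.+-inverseʳ (charPolyAt N t))))))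
  where
  regroup : ∀ p q T₁ T₂ S X → (T₂ - T₁) * X + ((p - (S - T₁ * X)) - (q - (S - T₂ * X))) ≡ p - q
  regroup = solve-∀

≗⇔≗-reparametrised : ∀ {p p′ q q′ : ℤ → ℤ} (s : ℤ) (φ ψ : ℤ → ℤ) → s * s ≡ + 1 → (∀ u → φ (ψ u) ≡ u)
  → (∀ t → p t ≡ s * q (φ t)) → (∀ t → p′ t ≡ s * q′ (φ t))
  → (p ≗ p′) ⇔ (q ≗ q′)
≗⇔≗-reparametrised {p} {p′} {q} {q′} s φ ψ s²≡1 φψ p≡ p′≡ = mk⇔ to from
  where
  s*s* : ∀ x → s * (s * x) ≡ x
  s*s* x = trans (sym (ℤP.*-assoc s s x)) (trans (cong (_* x) s²≡1) (ℤP.*-identityˡ x))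
  to : p ≗ p′ → q ≗ q′
  to p≗p′ u = begin
    q u                    ≡⟨ cong q (sym (φψ u)) ⟩
    q (φ (ψ u))            ≡⟨ sym (s*s* _) ⟩
    s * (s * q (φ (ψ u)))  ≡⟨ cong (s *_) (trans (sym (p≡ (ψ u))) (trans (p≗p′ (ψ u)) (p′≡ (ψ u)))) ⟩
    s * (s * q′ (φ (ψ u))) ≡⟨ s*s* _ ⟩
    q′ (φ (ψ u))           ≡⟨ cong q′ (φψ u) ⟩
    q′ u ∎
  from : q ≗ q′ → p ≗ p′
  from q≗q′ t = trans (p≡ t) (trans (cong (s *_) (q≗q′ (φ t))) (sym (p′≡ t)))

-- Graphs

Aₘ-diag : ∀ {n} (G : Graph n) i → Aₘ G i i ≡ + 0
Aₘ-diag G i rewrite adjIrr G i = refl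

sumFin-Aₘ-column : ∀ {n} (G : Graph n) j → sumFin (λ i → Aₘ G i j) ≡ + deg G j
sumFin-Aₘ-column G j = begin
  sumFin (λ i → Aₘ G i j)
    ≡⟨ sumFin-cong (λ i → cong (λ b → if b then + 1 else + 0) (adjSym G i j)) ⟩
  sumFin (λ i → Aₘ G j i)
    ≡⟨ sumFin-cong (λ i → pos-if (adj G j i)) ⟩
  sumFin (λ i → + (if adj G j i then 1 else 0))
    ≡⟨ sym (pos-sumFinℕ (λ i → if adj G j i then 1 else 0)) ⟩
  + deg G j ∎
  where
  pos-if : ∀ b → (if b then + 1 else + 0) ≡ + (if b then 1 else 0)
  pos-if true  = refl
  pos-if false = refl

module DiameterTwo {n} (G : Graph n) (d : Fin n → Fin n → ℕ) (dist : IsDistance G d) (diam : DiameterAtMost2 d) where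

  walk₀⇒≡ : ∀ {u v} → Walk G u v 0 → u ≡ v
  walk₀⇒≡ nil = refl

  walk₁⇒adj : ∀ {u v} → Walk G u v 1 → adj G u v ≡ true
  walk₁⇒adj (cons e nil) = e

  distance-offDiagonal : ∀ {i j} → i ≢ j → d i j ≡ (if adj G i j then 1 else 2)
  distance-offDiagonal {i} {j} i≢j with d i j | proj₁ (dist i j) | proj₂ (dist i j) | diam i j | adj G i j in i~j
  ... | 0 | w | _        | _ | _     = ⊥-elim (i≢j (walk₀⇒≡ w))
  ... | 1 | _ | _        | _ | true  = refl
  ... | 1 | w | _        | _ | false with () ← trans (sym i~j) (walk₁⇒adj w)
  ... | 2 | _ | _        | _ | false = refl
  ... | 2 | _ | shortest | _ | true  with ℕ.s≤s () ← shortest 1 (cons i~j nil)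
  ... | suc (suc (suc _)) | _ | _ | ℕ.s≤s (ℕ.s≤s ()) | _

  distance-entry : ∀ i j → + d i j ≡ + 2 * (+ 1 - δ i j) - Aₘ G i j
  distance-entry i j with i ≟ j
  ... | yes refl rewrite ℕP.n≤0⇒n≡0 (proj₂ (dist i i) 0 nil) | δ-diag i | Aₘ-diag G i = refl
  ... | no i≢j rewrite distance-offDiagonal i≢j | δ-≢ i≢j with adj G i j
  ...   | true  = refl
  ...   | false = refl

  transmission : ∀ v → + trs d v ≡ + 2 * + n - + 2 - + deg G v
  transmission v = begin
    + trs d v
      ≡⟨ pos-sumFinℕ (λ u → d u v) ⟩
    sumFin (λ u → + d u v)
      ≡⟨ sumFin-cong (λ u → trans (distance-entry u v) (expand (δ u v) (Aₘ G u v))) ⟩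
    sumFin (λ u → + 2 + (- + 2 * δ u v + - Aₘ G u v))
      ≡⟨ trans (sumFin-+ (const (+ 2)) (λ u → - + 2 * δ u v + - Aₘ G u v))
               (cong (_+_ (sumFin {n} (const (+ 2)))) (sumFin-+ (λ u → - + 2 * δ u v) (λ u → - Aₘ G u v))) ⟩
    sumFin {n} (const (+ 2)) + (sumFin (λ u → - + 2 * δ u v) + sumFin (λ u → - Aₘ G u v))
      ≡⟨ cong₂ _+_ (sumFin-const n (+ 2))
           (cong₂ _+_ (sym (*-sumFin (- + 2) (λ u → δ u v))) (sym (neg-sumFin (λ u → Aₘ G u v)))) ⟩
    + 2 * + n + (- + 2 * sumFin (λ u → δ u v) + - sumFin (λ u → Aₘ G u v))
      ≡⟨ cong₂ (λ x y → + 2 * + n + (- + 2 * x + - y)) (sumFin-δ v) (sumFin-Aₘ-column G v) ⟩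
    + 2 * + n + (- + 2 * + 1 + - + deg G v)
      ≡⟨ collect (+ n) (+ deg G v) ⟩
    + 2 * + n - + 2 - + deg G v ∎
    where
    expand : ∀ x a → + 2 * (+ 1 - x) - a ≡ + 2 + (- + 2 * x + - a)
    expand = solve-∀
    collect : ∀ n g → + 2 * n + (- + 2 * + 1 + - g) ≡ + 2 * n - + 2 - g
    collect = solve-∀

  DQₘ-entry : ∀ i j → DQₘ d i j ≡ (+ 2 * + n - + 4) * δ i j + twoJminusQ G i j
  DQₘ-entry i j = trans (cong₂ (λ x y → x * δ i j + y) (transmission i) (distance-entry i j))
                        (regroup (+ n) (+ deg G i) (δ i j) (Aₘ G i j))
    where
    regroup : ∀ n g x a → (+ 2 * n - + 2 - g) * x + (+ 2 * (+ 1 - x) - a) ≡ (+ 2 * n - + 4) * x + (+ 2 * + 1 - (g * x + a))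
    regroup = solve-∀

  Ddegₘ-entry : ∀ i j → Ddegₘ G d i j ≡ + 2 * δ i j - twoJminusQ G i j
  Ddegₘ-entry i j = trans (cong (λ y → + deg G i * δ i j - y) (distance-entry i j))
                          (regroup (+ deg G i) (δ i j) (Aₘ G i j))
    where
    regroup : ∀ g x a → g * x - (+ 2 * (+ 1 - x) - a) ≡ + 2 * x - (+ 2 * + 1 - (g * x + a))
    regroup = solve-∀

  charPolyAt-DQₘ : ∀ t → charPolyAt (DQₘ d) t ≡ + 1 * charPolyAt (twoJminusQ G) (t - (+ 2 * + n - + 4))
  charPolyAt-DQₘ t = trans (det-cong λ i j → trans (cong (λ y → t * δ i j - y) (DQₘ-entry i j)) (shift t _ (δ i j) _))
                           (sym (ℤP.*-identityˡ _))
    where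
    shift : ∀ t c x y → t * x - (c * x + y) ≡ (t - c) * x - y
    shift = solve-∀

  charPolyAt-Ddegₘ : ∀ t → charPolyAt (Ddegₘ G d) t ≡ sign n * charPolyAt (twoJminusQ G) (+ 2 - t)
  charPolyAt-Ddegₘ t = trans (det-cong λ i j → trans (cong (λ y → t * δ i j - y) (Ddegₘ-entry i j)) (reflect t (δ i j) _))
                             (det-neg (λ i j → (+ 2 - t) * δ i j - twoJminusQ G i j))
    where
    reflect : ∀ t x y → t * x - (+ 2 * x - y) ≡ - ((+ 2 - t) * x - y)
    reflect = solve-∀

module RegularGraph {m} (G : Graph (suc m)) (k : ℕ) (regular : ∀ i → deg G i ≡ k) where

  private
    s = sign (suc m)

  columnSum-tI+Q : ∀ t j → sumFin (λ i → t * δ i j + Qₘ G i j) ≡ t + + 2 * + k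
  columnSum-tI+Q t j = begin
    sumFin (λ i → t * δ i j + (+ deg G i * δ i j + Aₘ G i j))
      ≡⟨ sumFin-cong (λ i → trans (cong (λ g → t * δ i j + (+ g * δ i j + Aₘ G i j)) (regular i))
                                  (collect t (+ k) (δ i j) (Aₘ G i j))) ⟩
    sumFin (λ i → (t + + k) * δ i j + Aₘ G i j)
      ≡⟨ sumFin-+ (λ i → (t + + k) * δ i j) (λ i → Aₘ G i j) ⟩
    sumFin (λ i → (t + + k) * δ i j) + sumFin (λ i → Aₘ G i j)
      ≡⟨ cong₂ _+_ (sym (*-sumFin (t + + k) (λ i → δ i j))) (sumFin-Aₘ-column G j) ⟩
    (t + + k) * sumFin (λ i → δ i j) + + deg G j
      ≡⟨ cong₂ (λ x g → (t + + k) * x + + g) (sumFin-δ j) (regular j) ⟩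
    (t + + k) * + 1 + + k
      ≡⟨ simplify t (+ k) ⟩
    t + + 2 * + k ∎
    where
    collect : ∀ t k x a → t * x + (k * x + a) ≡ (t + k) * x + a
    collect = solve-∀
    simplify : ∀ t k → (t + k) * + 1 + k ≡ t + + 2 * k
    simplify = solve-∀

  -- tI - (2J - Q) = (tI + Q) - 2J, where tI + Q has column sums t + 2k and det (tI + Q) = ± χ_Q(-t).
  charPolyAt-2J-Q : ∀ t → (t + + 2 * + k) * charPolyAt (twoJminusQ G) t
                          ≡ (t + + 2 * + k + - + 2 * + suc m) * (s * charPolyAt (Qₘ G) (- t))
  charPolyAt-2J-Q t = begin
    (t + + 2 * + k) * charPolyAt (twoJminusQ G) t
      ≡⟨ cong ((t + + 2 * + k) *_) (det-cong λ i j → sym (move t (δ i j) (Qₘ G i j))) ⟩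
    (t + + 2 * + k) * det (λ i j → Y i j + - + 2)
      ≡⟨ det-addConstant Y (t + + 2 * + k) (- + 2) (columnSum-tI+Q t) ⟩
    (t + + 2 * + k + - + 2 * + suc m) * det Y
      ≡⟨ cong ((t + + 2 * + k + - + 2 * + suc m) *_) det-Y ⟩
    (t + + 2 * + k + - + 2 * + suc m) * (s * charPolyAt (Qₘ G) (- t)) ∎
    where
    Y : Mat (suc m)
    Y i j = t * δ i j + Qₘ G i j
    move : ∀ t x q → t * x + q + - + 2 ≡ t * x - (+ 2 * + 1 - q)
    move = solve-∀
    negate : ∀ t x q → - t * x - q ≡ - (t * x + q)
    negate = solve-∀
    det-Y : det Y ≡ s * charPolyAt (Qₘ G) (- t)
    det-Y = begin
      det Y                                         ≡⟨ sym (ℤP.*-identityˡ (det Y)) ⟩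
      + 1 * det Y                                   ≡⟨ cong (_* det Y) (sym (sign*sign≡1 (suc m))) ⟩
      s * s * det Y                                 ≡⟨ ℤP.*-assoc s s (det Y) ⟩
      s * (s * det Y)                               ≡⟨ cong (s *_) (sym (det-neg Y)) ⟩
      s * det (λ i j → - Y i j)                     ≡⟨ cong (s *_) (det-cong λ i j → sym (negate t (δ i j) (Qₘ G i j))) ⟩
      s * charPolyAt (Qₘ G) (- t) ∎

  charPolyAt-Q : ∀ u → (u + (+ 2 * + suc m - + 2 * + k)) * charPolyAt (Qₘ G) u
                       ≡ - s * ((- u + + 2 * + k) * charPolyAt (twoJminusQ G) (- u))
  charPolyAt-Q u = begin
    (u + (+ 2 * + suc m - + 2 * + k)) * charPolyAt (Qₘ G) u
      ≡⟨ sym (ℤP.*-identityˡ _) ⟩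
    + 1 * ((u + (+ 2 * + suc m - + 2 * + k)) * charPolyAt (Qₘ G) u)
      ≡⟨ cong (_* ((u + (+ 2 * + suc m - + 2 * + k)) * charPolyAt (Qₘ G) u)) (sym (sign*sign≡1 (suc m))) ⟩
    s * s * ((u + (+ 2 * + suc m - + 2 * + k)) * charPolyAt (Qₘ G) u)
      ≡⟨ regroup u (+ 2 * + k) (+ 2 * + suc m) s (charPolyAt (Qₘ G) u) ⟩
    - s * ((- u + + 2 * + k + - + 2 * + suc m) * (s * charPolyAt (Qₘ G) u))
      ≡⟨ cong (λ v → - s * ((- u + + 2 * + k + - + 2 * + suc m) * (s * charPolyAt (Qₘ G) v))) (sym (ℤP.neg-involutive u)) ⟩
    - s * ((- u + + 2 * + k + - + 2 * + suc m) * (s * charPolyAt (Qₘ G) (- - u)))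
      ≡⟨ cong (- s *_) (sym (charPolyAt-2J-Q (- u))) ⟩
    - s * ((- u + + 2 * + k) * charPolyAt (twoJminusQ G) (- u)) ∎
    where
    regroup : ∀ u c N s q → s * s * ((u + (N - c)) * q) ≡ - s * ((- u + c + - N) * (s * q))
    regroup = solve-∀

  trace-Q : trace (Qₘ G) ≡ + k * + suc m
  trace-Q = trans (sumFin-cong diagonal) (sumFin-const (suc m) (+ k))
    where
    diagonal : ∀ i → Qₘ G i i ≡ + k
    diagonal i rewrite regular i | δ-diag i | Aₘ-diag G i = trans (ℤP.+-identityʳ (+ k * + 1)) (ℤP.*-identityʳ (+ k))

  trace-2J-Q : trace (twoJminusQ G) ≡ (+ 2 - + k) * + suc m
  trace-2J-Q = trans (sumFin-cong diagonal) (sumFin-const (suc m) (+ 2 - + k))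
    where
    simplify : ∀ k → + 2 * + 1 - (k * + 1 + + 0) ≡ + 2 - k
    simplify = solve-∀
    diagonal : ∀ i → twoJminusQ G i i ≡ + 2 - + k
    diagonal i rewrite regular i | δ-diag i | Aₘ-diag G i = simplify (+ k)

regular-sameDegree-cospectral : ∀ {m} (G H : Graph (suc m)) k → (∀ i → deg G i ≡ k) → (∀ i → deg H i ≡ k)
  → Cospectral (twoJminusQ G) (twoJminusQ H) ⇔ Cospectral (Qₘ G) (Qₘ H)
regular-sameDegree-cospectral {m} G H k regularG regularH = mk⇔ to from
  where
  module G′ = RegularGraph G k regularG
  module H′ = RegularGraph H k regularH
  to : Cospectral (twoJminusQ G) (twoJminusQ H) → Cospectral (Qₘ G) (Qₘ H)
  to X≗ = cancelLinearFactor (suc (suc m)) (charPolyAt-Deg< (Qₘ G)) (charPolyAt-Deg< (Qₘ H))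
                             (+ 2 * + suc m - + 2 * + k) λ u →
    trans (G′.charPolyAt-Q u)
          (trans (cong (λ x → - sign (suc m) * ((- u + + 2 * + k) * x)) (X≗ (- u)))
                 (sym (H′.charPolyAt-Q u)))
  from : Cospectral (Qₘ G) (Qₘ H) → Cospectral (twoJminusQ G) (twoJminusQ H)
  from Q≗ = cancelLinearFactor (suc (suc m)) (charPolyAt-Deg< (twoJminusQ G)) (charPolyAt-Deg< (twoJminusQ H))
                               (+ 2 * + k) λ t →
    trans (G′.charPolyAt-2J-Q t)
          (trans (cong (λ x → (t + + 2 * + k + - + 2 * + suc m) * (sign (suc m) * x)) (Q≗ (- t)))
                 (sym (H′.charPolyAt-2J-Q t)))

cospectral-2J-Q⇒sameDegree : ∀ {m} (G H : Graph (suc m)) {k l} → (∀ i → deg G i ≡ k) → (∀ i → deg H i ≡ l)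
  → Cospectral (twoJminusQ G) (twoJminusQ H) → k ≡ l
cospectral-2J-Q⇒sameDegree {m} G H {k} {l} regularG regularH X≗ =
  ℤP.+-injective (trans (x≡2-[2-x] (+ k)) (trans (cong (_-_ (+ 2)) 2-k≡2-l) (sym (x≡2-[2-x] (+ l)))))
  where
  x≡2-[2-x] : ∀ x → x ≡ + 2 - (+ 2 - x)
  x≡2-[2-x] = solve-∀
  2-k≡2-l : + 2 - + k ≡ + 2 - + l
  2-k≡2-l = ℤP.*-cancelʳ-≡ (+ 2 - + k) (+ 2 - + l) (+ suc m)
    (trans (sym (RegularGraph.trace-2J-Q G k regularG))
      (trans (Cospectral⇒trace≡ (twoJminusQ G) (twoJminusQ H) X≗) (RegularGraph.trace-2J-Q H l regularH)))

cospectral-Q⇒sameDegree : ∀ {m} (G H : Graph (suc m)) {k l} → (∀ i → deg G i ≡ k) → (∀ i → deg H i ≡ l)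
  → Cospectral (Qₘ G) (Qₘ H) → k ≡ l
cospectral-Q⇒sameDegree {m} G H {k} {l} regularG regularH Q≗ =
  ℤP.+-injective (ℤP.*-cancelʳ-≡ (+ k) (+ l) (+ suc m)
  (trans (sym (RegularGraph.trace-Q G k regularG))
         (trans (Cospectral⇒trace≡ (Qₘ G) (Qₘ H) Q≗) (RegularGraph.trace-Q H l regularH))))

regular-cospectral-2J-Q⇔Q : ∀ {n} (G H : Graph n) → Regular G → Regular H
  → Cospectral (twoJminusQ G) (twoJminusQ H) ⇔ Cospectral (Qₘ G) (Qₘ H)
regular-cospectral-2J-Q⇔Q {zero}  G H _ _ = mk⇔ (λ _ _ → refl) (λ _ _ → refl)
regular-cospectral-2J-Q⇔Q {suc m} G H (k , regularG) (l , regularH) = mk⇔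
  (λ X≗ → Equivalence.to (equiv (cospectral-2J-Q⇒sameDegree G H regularG regularH X≗)) X≗)
  (λ Q≗ → Equivalence.from (equiv (cospectral-Q⇒sameDegree G H regularG regularH Q≗)) Q≗)
  where
  equiv : k ≡ l → Cospectral (twoJminusQ G) (twoJminusQ H) ⇔ Cospectral (Qₘ G) (Qₘ H)
  equiv refl = regular-sameDegree-cospectral G H k regularG regularH

mainTheorem5 : (n : ℕ) (G H : Graph n) (dG dH : Fin n → Fin n → ℕ)
    → Connected G → Connected H
    → IsDistance G dG → IsDistance H dH
    → DiameterAtMost2 dG → DiameterAtMost2 dH
    → ((Cospectral (DQₘ dG) (DQₘ dH) ⇔ Cospectral (twoJminusQ G) (twoJminusQ H))
       × (Cospectral (Ddegₘ G dG) (Ddegₘ H dH) ⇔ Cospectral (twoJminusQ G) (twoJminusQ H)))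
      × (Regular G → Regular H
         → (Cospectral (DQₘ dG) (DQₘ dH) ⇔ Cospectral (Qₘ G) (Qₘ H))
           × (Cospectral (Ddegₘ G dG) (Ddegₘ H dH) ⇔ Cospectral (Qₘ G) (Qₘ H)))
mainTheorem5 n G H dG dH _ _ distG distH diamG diamH =
  (DQ⇔2J-Q , Ddeg⇔2J-Q) ,
  λ regularG regularH → let 2J-Q⇔Q = regular-cospectral-2J-Q⇔Q G H regularG regularH
                        in 2J-Q⇔Q ⇔-∘ DQ⇔2J-Q , 2J-Q⇔Q ⇔-∘ Ddeg⇔2J-Q
  where
  module G′ = DiameterTwo G dG distG diamG
  module H′ = DiameterTwo H dH distH diamH
  shift : ℤ
  shift = + 2 * + n - + 4
  unshift : ∀ u c → u + c - c ≡ u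
  unshift = solve-∀
  reflect : ∀ u → + 2 - (+ 2 - u) ≡ u
  reflect = solve-∀
  DQ⇔2J-Q : Cospectral (DQₘ dG) (DQₘ dH) ⇔ Cospectral (twoJminusQ G) (twoJminusQ H)
  DQ⇔2J-Q = ≗⇔≗-reparametrised (+ 1) (_- shift) (_+ shift) refl (λ u → unshift u shift)
              G′.charPolyAt-DQₘ H′.charPolyAt-DQₘ
  Ddeg⇔2J-Q : Cospectral (Ddegₘ G dG) (Ddegₘ H dH) ⇔ Cospectral (twoJminusQ G) (twoJminusQ H)
  Ddeg⇔2J-Q = ≗⇔≗-reparametrised (sign n) (_-_ (+ 2)) (_-_ (+ 2)) (sign*sign≡1 n) reflect
                G′.charPolyAt-Ddegₘ H′.charPolyAt-Ddegₘ
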